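{- Let $\Pi$ be a subset of $S_3$ with $\emptyset\neq\Pi\subsetneq S_3$. Let $c$ be the number of indices $a\in\{1,2,3\}$ such that $\Pi\cap M_a=\emptyset$. - If $c=0$, then $p_\Pi(n)=2$ for all $n\ge 3$. - If $c=1$, then $p_\Pi(n)=\Theta(\log\log n)$ as $n\to\infty$. - If $c=2$, then $p_\Pi(n)=\Theta(\log n)$ as $n\to\infty$.
   Context: Let $n\ge3$. An ordering is a bijection $\phi:[n]\to[n]$, where $\phi(x)$ is the position of $x$. A ternary constraint is a triple $\mathbf x=(x_1,x_2,x_3)$ of distinct elements of $[n]$. Write elements of $S_3$ as words $abc$. Then $\mathrm{ord}(\phi,\mathbf x)$ is the word $abc\in S_3$ such that $\phi(x_a)<\phi(x_b)<\phi(x_c)$. For nonempty $\Pi\subseteq S_3$, a set $\Phi$ of orderings $\Pi$-solves the extreme ternary constraint problem if for every constraint $\mathbf x$ some $\phi\in\Phi$ has $\mathrm{ord}(\phi,\mathbf x)\in\Pi$. $p_\Pi(n)$ is the minimum size of such a $\Phi$. The middle classes are $M_1=\{213,312\}$, $M_2=\{123,321\}$ and $M_3=\{132,231\}$; $M_a$ is the set of words with $a$ in the middle position. -}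

module Defs where

open import Data.Nat using (ℕ; zero; suc; _+_; _*_; _≤_; _<ᵇ_)
open import Data.Nat.Logarithm using (⌊log₂_⌋)
open import Data.Bool using (Bool; true; false; if_then_else_; not; _∨_)
open import Data.Fin using (Fin; toℕ)
open import Data.Fin.Permutation using (Permutation′; _⟨$⟩ʳ_)
open import Data.Product using (Σ; ∃; _×_; _,_)
open import Relation.Binary.PropositionalEquality using (_≡_; _≢_)

data S3 : Set where
  w123 w132 w213 w231 w312 w321 : S3

data Idx : Set where
  i1 i2 i3 : Idx

-- Middle letter of a word; M_a = { w | mid w ≡ a }.
mid : S3 → Idx
mid w123 = i2
mid w132 = i3
mid w213 = i1
mid w231 = i3
mid w312 = i1
mid w321 = i2

SubS3 : Set
SubS3 = S3 → Bool

-- An ordering of [n] = Fin n: φ x is the position of x.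
Ordering : ℕ → Set
Ordering n = Permutation′ n

-- Word abc with p_a < p_b < p_c, for pairwise distinct positions p₁ p₂ p₃.
wordOf : ℕ → ℕ → ℕ → S3
wordOf p1 p2 p3 =
  if p1 <ᵇ p2
  then (if p2 <ᵇ p3 then w123 else (if p1 <ᵇ p3 then w132 else w312))
  else (if p1 <ᵇ p3 then w213 else (if p2 <ᵇ p3 then w231 else w321))

ord : ∀ {n} → Ordering n → Fin n → Fin n → Fin n → S3
ord φ x1 x2 x3 = wordOf (toℕ (φ ⟨$⟩ʳ x1)) (toℕ (φ ⟨$⟩ʳ x2)) (toℕ (φ ⟨$⟩ʳ x3))

Solves : SubS3 → (n k : ℕ) → (Fin k → Ordering n) → Set
Solves Π n k Φ =
  (x1 x2 x3 : Fin n) → x1 ≢ x2 → x1 ≢ x3 → x2 ≢ x3 →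
  Σ (Fin k) λ i → Π (ord (Φ i) x1 x2 x3) ≡ true

-- p_Π(n) ≤ k : some family of at most k orderings Π-solves.
pLe : SubS3 → ℕ → ℕ → Set
pLe Π n k = Σ ℕ λ m → m ≤ k × Σ (Fin m → Ordering n) λ Φ → Solves Π n m Φ

-- k ≤ p_Π(n) : every Π-solving family has at least k orderings.
pGe : SubS3 → ℕ → ℕ → Set
pGe Π n k = (m : ℕ) (Φ : Fin m → Ordering n) → Solves Π n m Φ → k ≤ m

pEq : SubS3 → ℕ → ℕ → Set
pEq Π n k = pLe Π n k × pGe Π n k

-- Positive real constants c₁,c₂
-- with c₁ f(n) ≤ p_Π(n) ≤ c₂ f(n) are equivalently replaced by a single
-- natural constant C with  p_Π(n) ≤ C·f(n)  and  f(n) ≤ C·p_Π(n).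
PTheta : SubS3 → (ℕ → ℕ) → Set
PTheta Π f = Σ ℕ λ C → Σ ℕ λ N → (n : ℕ) → N ≤ n →
  pLe Π n (C * f n) ×
  ((m : ℕ) (Φ : Fin m → Ordering n) → Solves Π n m Φ → f n ≤ C * m)

emptyMid : SubS3 → Idx → Bool
emptyMid Π i1 = not (Π w213 ∨ Π w312)
emptyMid Π i2 = not (Π w123 ∨ Π w321)
emptyMid Π i3 = not (Π w132 ∨ Π w231)

b2n : Bool → ℕ
b2n true = 1
b2n false = 0

cCount : SubS3 → ℕ
cCount Π = b2n (emptyMid Π i1) + b2n (emptyMid Π i2) + b2n (emptyMid Π i3)

module Submission where

-- Give every element of [n] a binary code of length L and
-- order [n] lexicographically by the codes after XOR with a mask.  For a
-- constraint (x₁,x₂,x₃) the codes split at a first position i where one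
-- of them, the odd one k, deviates, and the other two split later at j;
-- the word read off then depends only on the mask bits at i and j, and
-- every word whose middle letter is not k occurs (realize).  Choosing the
-- masks:  the all-0 and all-1 masks give a word and its reversal, hence
-- both members of a middle class (c = 0);  masks with prescribed bits at
-- any two positions, built from codes of the positions, give O(log L)
-- orderings (c = 1);  forcing the split position by prefixing one chosen
-- code bit gives O(L) orderings (c = 2).
--
-- One ordering yields only one word per triple (c = 0).  If
-- Π ⊆ M_a, two elements on the same side of a fixed x₀ in every ordering
-- give an unsolvable constraint, so n - 1 ≤ 2^m (c = 2).  If Π ∩ M_c = ∅,
-- an element lying between two others in every ordering gives an
-- unsolvable constraint; the set of "before/after patterns" realised
-- around each element must therefore be distinct, so n ≤ 2^(2^m) (c = 1).

open import Defs
open import Data.Bool using (Bool; true; false; not; _∨_; _xor_; if_then_else_)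
open import Data.Bool.Properties
  using (xor-assoc; xor-same; xor-identityʳ; xor-comm; true-xor; not-¬)
  renaming (_≟_ to _≟ᵇ_)
open import Data.Fin using (Fin; zero; suc; toℕ; fromℕ<; inject≤; remQuot; combine; punchOut; funToFin; finToFun)
open import Data.Fin.Properties
  using (toℕ-injective; toℕ-fromℕ<; inject≤-injective; suc-injective; remQuot-combine;
         injective⇒≤; punchOut-injective; any?; all?; funToFin-finToFin; finToFun-funToFin)
  renaming (_≟_ to _≟ᶠ_)
open import Data.Fin.Permutation using (permutation; _⟨$⟩ʳ_; _⟨$⟩ˡ_; inverseˡ; inverseʳ)
open import Data.Fin.Subset using (Subset; ∣_∣; _∈_; _∉_; _⊆_)
open import Data.Fin.Subset.Properties using (p⊂q⇒∣p∣<∣q∣; ∈⊤; ⊆⊤; ∣⊤∣≡n)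
open import Data.Nat using (ℕ; zero; suc; _+_; _*_; _^_; _≤_; _<_; _<ᵇ_; _≤?_; z≤n; s≤s)
open import Data.Nat.Properties
  using (<-cmp; <-trans; <⇒≤; <⇒≢; ≤-refl; ≤-trans; ≤-reflexive; ≰⇒>; 1+n≰n; +-mono-≤; +-monoˡ-≤;
         *-monoˡ-≤; +-identityʳ; m≤n*m; m≤m*n; m^n>0)
open import Data.Nat.Logarithm using (⌊log₂_⌋; ⌊log₂⌋-mono-≤; ⌊log₂[2^n]⌋≡n)
open import Data.Nat.Tactic.RingSolver using (solve-∀)
open import Data.Product using (Σ; _×_; _,_; proj₁; proj₂; map; map₂)
open import Data.Sum using (_⊎_; inj₁; inj₂)
import Data.Sum as Sum
open import Data.Vec using (Vec; []; _∷_; lookup; replicate; tabulate; zipWith)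
open import Data.Vec.Properties using (∷-injectiveˡ; ∷-injectiveʳ; lookup∘tabulate; lookup-replicate; []=⇒lookup; lookup⇒[]=)
open import Function using (_∘_)
open import Function.Definitions using (Injective)
open import Relation.Binary using (tri<; tri≈; tri>)
open import Relation.Binary.PropositionalEquality
  using (_≡_; _≢_; _≗_; refl; sym; trans; cong; cong₂; subst; ≢-sym; module ≡-Reasoning)
open import Relation.Nullary using (¬_; Dec; yes; no; does; contradiction)
open import Relation.Nullary.Decidable using (dec-true; ¬?; _×-dec_)

<ᵇ-true : ∀ {p q} → p < q → (p <ᵇ q) ≡ true
<ᵇ-true {zero}  {suc q} _         = refl
<ᵇ-true {suc p} {suc q} (s≤s p<q) = <ᵇ-true p<q

<ᵇ-false : ∀ {p q} → q ≤ p → (p <ᵇ q) ≡ false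
<ᵇ-false {p}     {zero}  _         = refl
<ᵇ-false {suc p} {suc q} (s≤s q≤p) = <ᵇ-false q≤p

<ᵇ-sound : ∀ {p q} → (p <ᵇ q) ≡ true → p < q
<ᵇ-sound {zero}  {suc q} _ = s≤s z≤n
<ᵇ-sound {suc p} {suc q} h = s≤s (<ᵇ-sound h)

<ᵇ-trans : ∀ {p q r} → (p <ᵇ q) ≡ true → (q <ᵇ r) ≡ true → (p <ᵇ r) ≡ true
<ᵇ-trans {p} {q} {r} pq qr = <ᵇ-true (<-trans (<ᵇ-sound {p} {q} pq) (<ᵇ-sound {q} {r} qr))

<ᵇ-flip : ∀ {p q} → p ≢ q → (q <ᵇ p) ≡ not (p <ᵇ q)
<ᵇ-flip {p} {q} p≢q with <-cmp p q
... | tri< p<q _ _   rewrite <ᵇ-true p<q = <ᵇ-false (<⇒≤ p<q)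
... | tri≈ _ p≡q _   = contradiction p≡q p≢q
... | tri> _ _ q<p   rewrite <ᵇ-true q<p | <ᵇ-false (<⇒≤ q<p) = refl

<ᵇ-between : ∀ {p q r} → p ≢ q → p ≢ r → q ≢ r →
             (q <ᵇ p) ≡ not (r <ᵇ p) → (q <ᵇ r) ≡ (q <ᵇ p)
<ᵇ-between {p} {q} {r} p≢q p≢r q≢r h with q <ᵇ p in qp | r <ᵇ p in rp
... | true  | false = <ᵇ-trans {q} {p} {r} qp (trans (<ᵇ-flip (≢-sym p≢r)) (cong not rp))
... | false | true  =
  trans (<ᵇ-flip {r} {q} (≢-sym q≢r))
        (cong not (<ᵇ-trans {r} {p} {q} rp (trans (<ᵇ-flip {q} {p} (≢-sym p≢q)) (cong not qp))))
... | true  | true  = contradiction h λ ()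
... | false | false = contradiction h λ ()

-- The word of a triple from its comparisons "1 before 2", "2 before 3"
-- and "1 before 3"; by definition  wordOf p q r = word3 (p <ᵇ q) (q <ᵇ r) (p <ᵇ r).
word3 : Bool → Bool → Bool → S3
word3 b₁₂ b₂₃ b₁₃ =
  if b₁₂ then (if b₂₃ then w123 else (if b₁₃ then w132 else w312))
  else (if b₁₃ then w213 else (if b₂₃ then w231 else w321))

rev : S3 → S3
rev w123 = w321
rev w132 = w231
rev w213 = w312
rev w231 = w132
rev w312 = w213
rev w321 = w123

-- The word of a triple in which element k is first or last, the two others
-- being adjacent: A says whether k comes first, B how the other two compare.
shapeWord : Idx → Bool → Bool → S3
shapeWord i1 A B = word3 A B A
shapeWord i2 A B = word3 (not A) A B
shapeWord i3 A B = word3 B (not A) (not A)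

realize : ∀ k w → mid w ≢ k → Σ Bool λ A → Σ Bool λ B → shapeWord k A B ≡ w
realize i1 w123 _ = true  , true  , refl
realize i1 w132 _ = true  , false , refl
realize i1 w231 _ = false , true  , refl
realize i1 w321 _ = false , false , refl
realize i1 w213 m≢k = contradiction refl m≢k
realize i1 w312 m≢k = contradiction refl m≢k
realize i2 w213 _ = true  , true  , refl
realize i2 w231 _ = true  , false , refl
realize i2 w132 _ = false , true  , refl
realize i2 w312 _ = false , false , refl
realize i2 w123 m≢k = contradiction refl m≢k
realize i2 w321 m≢k = contradiction refl m≢k
realize i3 w312 _ = true  , true  , refl
realize i3 w321 _ = true  , false , refl
realize i3 w123 _ = false , true  , refl
realize i3 w213 _ = false , false , refl
realize i3 w132 m≢k = contradiction refl m≢k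
realize i3 w231 m≢k = contradiction refl m≢k

shapeWord-flip : ∀ k A B → shapeWord k (not A) (not B) ≡ rev (shapeWord k A B)
shapeWord-flip i1 false false = refl
shapeWord-flip i1 false true  = refl
shapeWord-flip i1 true  false = refl
shapeWord-flip i1 true  true  = refl
shapeWord-flip i2 false false = refl
shapeWord-flip i2 false true  = refl
shapeWord-flip i2 true  false = refl
shapeWord-flip i2 true  true  = refl
shapeWord-flip i3 false false = refl
shapeWord-flip i3 false true  = refl
shapeWord-flip i3 true  false = refl
shapeWord-flip i3 true  true  = refl

nor-false : ∀ x y → not (x ∨ y) ≡ false → x ≡ true ⊎ y ≡ true
nor-false true  y    _ = inj₁ refl
nor-false false true _ = inj₂ refl

nor-true : ∀ x y → not (x ∨ y) ≡ true → x ≡ false × y ≡ false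
nor-true false false _ = refl , refl

-- The middle class of w is {w, rev w}; if Π meets it, Π contains one of them.
cover : ∀ Π w → emptyMid Π (mid w) ≡ false → Π w ≡ true ⊎ Π (rev w) ≡ true
cover Π w123 h = nor-false (Π w123) (Π w321) h
cover Π w321 h = Sum.swap (nor-false (Π w123) (Π w321) h)
cover Π w213 h = nor-false (Π w213) (Π w312) h
cover Π w312 h = Sum.swap (nor-false (Π w213) (Π w312) h)
cover Π w132 h = nor-false (Π w132) (Π w231) h
cover Π w231 h = Sum.swap (nor-false (Π w132) (Π w231) h)

disjoint : ∀ Π a → emptyMid Π a ≡ true → ∀ w → mid w ≡ a → Π w ≡ false
disjoint Π .i1 h w213 refl = proj₁ (nor-true (Π w213) (Π w312) h)
disjoint Π .i1 h w312 refl = proj₂ (nor-true (Π w213) (Π w312) h)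
disjoint Π .i2 h w123 refl = proj₁ (nor-true (Π w123) (Π w321) h)
disjoint Π .i2 h w321 refl = proj₂ (nor-true (Π w123) (Π w321) h)
disjoint Π .i3 h w132 refl = proj₁ (nor-true (Π w132) (Π w231) h)
disjoint Π .i3 h w231 refl = proj₂ (nor-true (Π w132) (Π w231) h)

meets : ∀ Π a → emptyMid Π a ≡ false → Σ S3 λ w → mid w ≡ a × Π w ≡ true
meets Π i1 h = Sum.[ (λ p → w213 , refl , p) , (λ p → w312 , refl , p) ] (nor-false (Π w213) (Π w312) h)
meets Π i2 h = Sum.[ (λ p → w123 , refl , p) , (λ p → w321 , refl , p) ] (nor-false (Π w123) (Π w321) h)
meets Π i3 h = Sum.[ (λ p → w132 , refl , p) , (λ p → w231 , refl , p) ] (nor-false (Π w132) (Π w231) h)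

other₁ other₂ : Idx → Idx
other₁ i1 = i2
other₁ i2 = i1
other₁ i3 = i1
other₂ i1 = i3
other₂ i2 = i3
other₂ i3 = i2

pick : ∀ {A : Set} → A → A → A → Idx → A
pick x₁ x₂ x₃ i1 = x₁
pick x₁ x₂ x₃ i2 = x₂
pick x₁ x₂ x₃ i3 = x₃

pick-map : ∀ {A B : Set} (f : A → B) x₁ x₂ x₃ a → pick (f x₁) (f x₂) (f x₃) a ≡ f (pick x₁ x₂ x₃ a)
pick-map f x₁ x₂ x₃ i1 = refl
pick-map f x₁ x₂ x₃ i2 = refl
pick-map f x₁ x₂ x₃ i3 = refl

pick-distinct : ∀ {A : Set} {x₁ x₂ x₃ : A} → x₁ ≢ x₂ → x₁ ≢ x₃ → x₂ ≢ x₃ →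
                ∀ r → pick x₁ x₂ x₃ (other₁ r) ≢ pick x₁ x₂ x₃ (other₂ r)
pick-distinct d₁₂ d₁₃ d₂₃ i1 = d₂₃
pick-distinct d₁₂ d₁₃ d₂₃ i2 = d₁₃
pick-distinct d₁₂ d₁₃ d₂₃ i3 = d₁₂

pick-notAllEqual : ∀ {A : Set} {x₁ x₂ x₃ : A} r → pick x₁ x₂ x₃ (other₁ r) ≢ pick x₁ x₂ x₃ (other₂ r) →
                   ¬ (x₁ ≡ x₂ × x₂ ≡ x₃)
pick-notAllEqual i1 ne (e₁₂ , e₂₃) = ne e₂₃
pick-notAllEqual i2 ne (e₁₂ , e₂₃) = ne (trans e₁₂ e₂₃)
pick-notAllEqual i3 ne (e₁₂ , e₂₃) = ne e₁₂

other-avoids : ∀ c k → other₁ c ≢ k ⊎ other₂ c ≢ k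
other-avoids i1 i1 = inj₁ λ ()
other-avoids i1 i2 = inj₂ λ ()
other-avoids i1 i3 = inj₁ λ ()
other-avoids i2 i1 = inj₂ λ ()
other-avoids i2 i2 = inj₁ λ ()
other-avoids i2 i3 = inj₁ λ ()
other-avoids i3 i1 = inj₂ λ ()
other-avoids i3 i2 = inj₁ λ ()
other-avoids i3 i3 = inj₁ λ ()

count₀ : ∀ (f : Idx → Bool) → b2n (f i1) + b2n (f i2) + b2n (f i3) ≡ 0 → ∀ a → f a ≡ false
count₀ f h a with f i1 in e₁ | f i2 in e₂ | f i3 in e₃
count₀ f h i1 | false | false | false = e₁
count₀ f h i2 | false | false | false = e₂
count₀ f h i3 | false | false | false = e₃
count₀ f () a | true  | _     | _
count₀ f () a | false | true  | _
count₀ f () a | false | false | true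

count₁ : ∀ (f : Idx → Bool) → b2n (f i1) + b2n (f i2) + b2n (f i3) ≡ 1 →
         Σ Idx λ c → f c ≡ true × f (other₁ c) ≡ false × f (other₂ c) ≡ false
count₁ f h with f i1 in e₁ | f i2 in e₂ | f i3 in e₃
count₁ f h  | true  | false | false = i1 , e₁ , e₂ , e₃
count₁ f h  | false | true  | false = i2 , e₂ , e₁ , e₃
count₁ f h  | false | false | true  = i3 , e₃ , e₁ , e₂
count₁ f () | true  | true  | _
count₁ f () | true  | false | true
count₁ f () | false | true  | true
count₁ f () | false | false | false

count₂ : ∀ (f : Idx → Bool) → b2n (f i1) + b2n (f i2) + b2n (f i3) ≡ 2 →
         Σ Idx λ a → ∀ b → b ≢ a → f b ≡ true
count₂ f h with f i1 in e₁ | f i2 in e₂ | f i3 in e₃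
count₂ f h  | false | true  | true  = i1 , λ { i1 b≢a → contradiction refl b≢a ; i2 _ → e₂ ; i3 _ → e₃ }
count₂ f h  | true  | false | true  = i2 , λ { i2 b≢a → contradiction refl b≢a ; i1 _ → e₁ ; i3 _ → e₃ }
count₂ f h  | true  | true  | false = i3 , λ { i3 b≢a → contradiction refl b≢a ; i1 _ → e₁ ; i2 _ → e₂ }
count₂ f () | true  | true  | true
count₂ f () | true  | false | false
count₂ f () | false | true  | false
count₂ f () | false | false | true
count₂ f () | false | false | false

pos : ∀ {n} → Ordering n → Fin n → ℕ
pos φ x = toℕ (φ ⟨$⟩ʳ x)

before : ∀ {n} → Ordering n → Fin n → Fin n → Bool
before φ y x = pos φ y <ᵇ pos φ x

pos-≢ : ∀ {n} (φ : Ordering n) {x y} → x ≢ y → pos φ x ≢ pos φ y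
pos-≢ φ {x} {y} x≢y eq = x≢y (begin
  x                       ≡⟨ sym (inverseˡ φ) ⟩
  φ ⟨$⟩ˡ (φ ⟨$⟩ʳ x)        ≡⟨ cong (φ ⟨$⟩ˡ_) (toℕ-injective eq) ⟩
  φ ⟨$⟩ˡ (φ ⟨$⟩ʳ y)        ≡⟨ inverseˡ φ ⟩
  y                       ∎)
  where open ≡-Reasoning

before-flip : ∀ {n} (φ : Ordering n) {x y} → x ≢ y → before φ x y ≡ not (before φ y x)
before-flip φ x≢y = <ᵇ-flip (pos-≢ φ (≢-sym x≢y))

injective⇒onto : ∀ {n} (f : Fin n → Fin n) → Injective _≡_ _≡_ f → ∀ j → Σ (Fin n) λ i → f i ≡ j
injective⇒onto {suc n} f f-inj j with any? (λ i → f i ≟ᶠ j)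
... | yes found = found
... | no missed = contradiction (injective⇒≤ squeeze-injective) 1+n≰n
  where
  avoids : ∀ i → j ≢ f i
  avoids i eq = missed (i , sym eq)
  -- f with the value j removed from its codomain
  squeeze : Fin (suc n) → Fin n
  squeeze i = punchOut (avoids i)
  squeeze-injective : Injective _≡_ _≡_ squeeze
  squeeze-injective eq = f-inj (punchOut-injective (avoids _) (avoids _) eq)

fromInjection : ∀ {n} (f : Fin n → Fin n) → Injective _≡_ _≡_ f → Ordering n
fromInjection f f-inj = permutation f (λ j → proj₁ (onto j)) (λ j → proj₂ (onto j))
                                      (λ i → f-inj (proj₂ (onto (f i))))
  where onto = injective⇒onto f f-inj

-- Ordering [n] by injective keys in a strict total order with Boolean
-- comparison: the position of x is the number of elements with a smaller key.
module KeyOrdering {K : Set} (_≺_ : K → K → Bool)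
  (≺-irrefl : ∀ u → (u ≺ u) ≡ false)
  (≺-trans : ∀ {u v w} → (u ≺ v) ≡ true → (v ≺ w) ≡ true → (u ≺ w) ≡ true)
  (≺-connex : ∀ {u v} → u ≢ v → (u ≺ v) ≡ true ⊎ (v ≺ u) ≡ true)
  {n : ℕ} (key : Fin n → K) (key-injective : Injective _≡_ _≡_ key) where

  ≺-asym : ∀ {u v} → (u ≺ v) ≡ true → (v ≺ u) ≡ false
  ≺-asym {u} {v} uv with v ≺ u in vu
  ... | false = refl
  ... | true  = contradiction (trans (sym (≺-trans uv vu)) (≺-irrefl u)) λ ()

  below : Fin n → Subset n
  below x = tabulate (λ y → key y ≺ key x)

  ∈-below : ∀ {x y} → (key y ≺ key x) ≡ true → y ∈ below x
  ∈-below {x} {y} h = lookup⇒[]= y (below x) (trans (lookup∘tabulate _ y) h)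

  ∈-below⁻¹ : ∀ {x y} → y ∈ below x → (key y ≺ key x) ≡ true
  ∈-below⁻¹ {x} {y} y∈ = trans (sym (lookup∘tabulate _ y)) ([]=⇒lookup y∈)

  ∉-below-self : ∀ x → x ∉ below x
  ∉-below-self x x∈ = contradiction (trans (sym (∈-below⁻¹ x∈)) (≺-irrefl (key x))) λ ()

  below-⊆ : ∀ {x y} → (key x ≺ key y) ≡ true → below x ⊆ below y
  below-⊆ xy z∈ = ∈-below (≺-trans (∈-below⁻¹ z∈) xy)

  rank : Fin n → ℕ
  rank x = ∣ below x ∣

  rank<n : ∀ x → rank x < n
  rank<n x = subst (rank x <_) (∣⊤∣≡n n) (p⊂q⇒∣p∣<∣q∣ (⊆⊤ , x , ∈⊤ , ∉-below-self x))

  rank-mono : ∀ {x y} → (key x ≺ key y) ≡ true → rank x < rank y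
  rank-mono {x} xy = p⊂q⇒∣p∣<∣q∣ (below-⊆ xy , x , ∈-below xy , ∉-below-self x)

  rank-cmp : ∀ {x y} → x ≢ y → (rank x <ᵇ rank y) ≡ (key x ≺ key y)
  rank-cmp x≢y with ≺-connex (x≢y ∘ key-injective)
  ... | inj₁ xy rewrite xy = <ᵇ-true (rank-mono xy)
  ... | inj₂ yx rewrite ≺-asym yx = <ᵇ-false (<⇒≤ (rank-mono yx))

  rankPos : Fin n → Fin n
  rankPos x = fromℕ< (rank<n x)

  toℕ-rankPos : ∀ x → toℕ (rankPos x) ≡ rank x
  toℕ-rankPos x = toℕ-fromℕ< (rank<n x)

  rankPos-rank : ∀ {x y} → rankPos x ≡ rankPos y → rank x ≡ rank y
  rankPos-rank {x} {y} eq = trans (sym (toℕ-rankPos x)) (trans (cong toℕ eq) (toℕ-rankPos y))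

  rankPos-injective : Injective _≡_ _≡_ rankPos
  rankPos-injective {x} {y} eq with x ≟ᶠ y
  ... | yes x≡y = x≡y
  ... | no x≢y with ≺-connex (x≢y ∘ key-injective)
  ...   | inj₁ xy = contradiction (rankPos-rank eq) (<⇒≢ (rank-mono xy))
  ...   | inj₂ yx = contradiction (sym (rankPos-rank eq)) (<⇒≢ (rank-mono yx))

  keyOrder : Ordering n
  keyOrder = fromInjection rankPos rankPos-injective

  ord-keyOrder : ∀ {x₁ x₂ x₃} → x₁ ≢ x₂ → x₁ ≢ x₃ → x₂ ≢ x₃ →
                 ord keyOrder x₁ x₂ x₃ ≡ word3 (key x₁ ≺ key x₂) (key x₂ ≺ key x₃) (key x₁ ≺ key x₃)
  ord-keyOrder {x₁} {x₂} {x₃} d₁₂ d₁₃ d₂₃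
    rewrite toℕ-rankPos x₁ | toℕ-rankPos x₂ | toℕ-rankPos x₃
          | rank-cmp d₁₂ | rank-cmp d₂₃ | rank-cmp d₁₃ = refl

_≺_ : ∀ {L} → Vec Bool L → Vec Bool L → Bool
[]          ≺ []          = false
(false ∷ u) ≺ (false ∷ v) = u ≺ v
(false ∷ u) ≺ (true  ∷ v) = true
(true  ∷ u) ≺ (false ∷ v) = false
(true  ∷ u) ≺ (true  ∷ v) = u ≺ v

≺-cons : ∀ {L} x (u v : Vec Bool L) → ((x ∷ u) ≺ (x ∷ v)) ≡ (u ≺ v)
≺-cons false u v = refl
≺-cons true  u v = refl

≺-head : ∀ {L} {x y} (u v : Vec Bool L) → x ≢ y → ((x ∷ u) ≺ (y ∷ v)) ≡ y
≺-head {x = false} {false} u v x≢y = contradiction refl x≢y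
≺-head {x = false} {true}  u v _   = refl
≺-head {x = true}  {false} u v _   = refl
≺-head {x = true}  {true}  u v x≢y = contradiction refl x≢y

≺-irrefl : ∀ {L} (u : Vec Bool L) → (u ≺ u) ≡ false
≺-irrefl []          = refl
≺-irrefl (false ∷ u) = ≺-irrefl u
≺-irrefl (true  ∷ u) = ≺-irrefl u

≺-trans : ∀ {L} {u v w : Vec Bool L} → (u ≺ v) ≡ true → (v ≺ w) ≡ true → (u ≺ w) ≡ true
≺-trans {u = false ∷ u} {false ∷ v} {false ∷ w} uv vw = ≺-trans {u = u} {v} {w} uv vw
≺-trans {u = false ∷ u} {false ∷ v} {true  ∷ w} uv vw = refl
≺-trans {u = false ∷ u} {true  ∷ v} {true  ∷ w} uv vw = refl
≺-trans {u = true  ∷ u} {true  ∷ v} {true  ∷ w} uv vw = ≺-trans {u = u} {v} {w} uv vw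
≺-trans {u = []} {[]} {[]} () vw

≺-connex : ∀ {L} {u v : Vec Bool L} → u ≢ v → (u ≺ v) ≡ true ⊎ (v ≺ u) ≡ true
≺-connex {u = []}        {[]}        u≢v = contradiction refl u≢v
≺-connex {u = false ∷ u} {false ∷ v} u≢v = ≺-connex (u≢v ∘ cong (false ∷_))
≺-connex {u = false ∷ u} {true  ∷ v} _   = inj₁ refl
≺-connex {u = true  ∷ u} {false ∷ v} _   = inj₂ refl
≺-connex {u = true  ∷ u} {true  ∷ v} u≢v = ≺-connex (u≢v ∘ cong (true ∷_))

lexWord : ∀ {L} → Vec Bool L → Vec Bool L → Vec Bool L → S3
lexWord u₁ u₂ u₃ = word3 (u₁ ≺ u₂) (u₂ ≺ u₃) (u₁ ≺ u₃)

lexWord-cons : ∀ {L} x (u₁ u₂ u₃ : Vec Bool L) → lexWord (x ∷ u₁) (x ∷ u₂) (x ∷ u₃) ≡ lexWord u₁ u₂ u₃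
lexWord-cons false u₁ u₂ u₃ = refl
lexWord-cons true  u₁ u₂ u₃ = refl

_⊕_ : ∀ {L} → Vec Bool L → Vec Bool L → Vec Bool L
_⊕_ = zipWith _xor_

xor-true : ∀ x → x xor true ≡ not x
xor-true x = trans (xor-comm x true) (true-xor x)

xor-cancelʳ : ∀ x m → (x xor m) xor m ≡ x
xor-cancelʳ x m = trans (xor-assoc x m m) (trans (cong (x xor_) (xor-same m)) (xor-identityʳ x))

xor-cancelˡ : ∀ m x → m xor (m xor x) ≡ x
xor-cancelˡ m x = trans (sym (xor-assoc m m x)) (cong (_xor x) (xor-same m))

xor-injective : ∀ {x y} m → x xor m ≡ y xor m → x ≡ y
xor-injective {x} {y} m eq = trans (sym (xor-cancelʳ x m)) (trans (cong (_xor m) eq) (xor-cancelʳ y m))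

⊕-injective : ∀ {L} {u v : Vec Bool L} M → u ⊕ M ≡ v ⊕ M → u ≡ v
⊕-injective {u = []}    {[]}    []      _  = refl
⊕-injective {u = x ∷ u} {y ∷ v} (m ∷ M) eq =
  cong₂ _∷_ (xor-injective m (∷-injectiveˡ eq)) (⊕-injective M (∷-injectiveʳ eq))

firstDiff : ∀ {L} (u v : Vec Bool L) → u ≢ v →
            Σ (Fin L) λ j → lookup u j ≢ lookup v j ×
                            (∀ M → ((u ⊕ M) ≺ (v ⊕ M)) ≡ (lookup v j xor lookup M j))
firstDiff []      []      u≢v = contradiction refl u≢v
firstDiff (x ∷ u) (y ∷ v) u≢v with x ≟ᵇ y
... | no x≢y  = zero , x≢y , λ { (m ∷ M) → ≺-head (u ⊕ M) (v ⊕ M) (x≢y ∘ xor-injective m) }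
... | yes refl =
  let j , differ , larger = firstDiff u v (u≢v ∘ cong (x ∷_))
  in  suc j , differ , λ { (m ∷ M) → trans (≺-cons (x xor m) (u ⊕ M) (v ⊕ M)) (larger M) }

-- Under every mask, the word of u₁ u₂ u₃ is the shape word of the odd
-- string, decided by the mask bits at positions i and j.
record Split {L : ℕ} (u₁ u₂ u₃ : Vec Bool L) : Set where
  constructor split
  field
    odd   : Idx
    i j   : Fin L
    i≢j   : i ≢ j
    b c   : Bool
    shape : ∀ M → lexWord (u₁ ⊕ M) (u₂ ⊕ M) (u₃ ⊕ M) ≡ shapeWord odd (b xor lookup M i) (c xor lookup M j)

tail-≢ : ∀ {L} {x : Bool} {u v : Vec Bool L} → (x ∷ u) ≢ (x ∷ v) → u ≢ v
tail-≢ ne = ne ∘ cong (_ ∷_)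

-- If the first bits are not all equal, the string whose first bit differs
-- is odd and the split happens at position 0; b is the common first bit of
-- the two others, and each case is checked for both values of the first
-- mask bit, which makes the comparisons at position 0 compute.
headSplit : ∀ {L} (a₁ a₂ a₃ : Bool) (u₁ u₂ u₃ : Vec Bool L) → ¬ (a₁ ≡ a₂ × a₂ ≡ a₃) →
            (a₁ ∷ u₁) ≢ (a₂ ∷ u₂) → (a₁ ∷ u₁) ≢ (a₃ ∷ u₃) → (a₂ ∷ u₂) ≢ (a₃ ∷ u₃) →
            Σ (Split (a₁ ∷ u₁) (a₂ ∷ u₂) (a₃ ∷ u₃)) λ s →
              Split.i s ≡ zero × pick a₁ a₂ a₃ (other₁ (Split.odd s)) ≡ pick a₁ a₂ a₃ (other₂ (Split.odd s))
headSplit false false false _ _ _ notAll _ _ _ = contradiction (refl , refl) notAll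
headSplit true  true  true  _ _ _ notAll _ _ _ = contradiction (refl , refl) notAll
headSplit true  false false u₁ u₂ u₃ _ _ _ d₂₃ =
  let j , _ , larger = firstDiff u₂ u₃ (tail-≢ d₂₃) in
  split i1 zero (suc j) (λ ()) false (lookup u₃ j)
    (λ { (false ∷ M) → cong (shapeWord i1 false) (larger M)
       ; (true  ∷ M) → cong (shapeWord i1 true)  (larger M) }) , refl , refl
headSplit false true  true  u₁ u₂ u₃ _ _ _ d₂₃ =
  let j , _ , larger = firstDiff u₂ u₃ (tail-≢ d₂₃) in
  split i1 zero (suc j) (λ ()) true (lookup u₃ j)
    (λ { (false ∷ M) → cong (shapeWord i1 true)  (larger M)
       ; (true  ∷ M) → cong (shapeWord i1 false) (larger M) }) , refl , refl
headSplit false true  false u₁ u₂ u₃ _ _ d₁₃ _ =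
  let j , _ , larger = firstDiff u₁ u₃ (tail-≢ d₁₃) in
  split i2 zero (suc j) (λ ()) false (lookup u₃ j)
    (λ { (false ∷ M) → cong (shapeWord i2 false) (larger M)
       ; (true  ∷ M) → cong (shapeWord i2 true)  (larger M) }) , refl , refl
headSplit true  false true  u₁ u₂ u₃ _ _ d₁₃ _ =
  let j , _ , larger = firstDiff u₁ u₃ (tail-≢ d₁₃) in
  split i2 zero (suc j) (λ ()) true (lookup u₃ j)
    (λ { (false ∷ M) → cong (shapeWord i2 true)  (larger M)
       ; (true  ∷ M) → cong (shapeWord i2 false) (larger M) }) , refl , refl
headSplit false false true  u₁ u₂ u₃ _ d₁₂ _ _ =
  let j , _ , larger = firstDiff u₁ u₂ (tail-≢ d₁₂) in
  split i3 zero (suc j) (λ ()) false (lookup u₂ j)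
    (λ { (false ∷ M) → cong (shapeWord i3 false) (larger M)
       ; (true  ∷ M) → cong (shapeWord i3 true)  (larger M) }) , refl , refl
headSplit true  true  false u₁ u₂ u₃ _ d₁₂ _ _ =
  let j , _ , larger = firstDiff u₁ u₂ (tail-≢ d₁₂) in
  split i3 zero (suc j) (λ ()) true (lookup u₂ j)
    (λ { (false ∷ M) → cong (shapeWord i3 true)  (larger M)
       ; (true  ∷ M) → cong (shapeWord i3 false) (larger M) }) , refl , refl

consSplit : ∀ {L} x {u₁ u₂ u₃ : Vec Bool L} → Split u₁ u₂ u₃ → Split (x ∷ u₁) (x ∷ u₂) (x ∷ u₃)
consSplit x {u₁} {u₂} {u₃} (split k i j i≢j b c shape) =
  split k (suc i) (suc j) (i≢j ∘ suc-injective) b c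
    λ { (m ∷ M) → trans (lexWord-cons (x xor m) (u₁ ⊕ M) (u₂ ⊕ M) (u₃ ⊕ M)) (shape M) }

tripleSplit : ∀ {L} (u₁ u₂ u₃ : Vec Bool L) → u₁ ≢ u₂ → u₁ ≢ u₃ → u₂ ≢ u₃ → Split u₁ u₂ u₃
tripleSplit []        []        []        d₁₂ _   _   = contradiction refl d₁₂
tripleSplit (a₁ ∷ u₁) (a₂ ∷ u₂) (a₃ ∷ u₃) d₁₂ d₁₃ d₂₃ with a₁ ≟ᵇ a₂ | a₂ ≟ᵇ a₃
... | yes refl | yes refl = consSplit a₁ (tripleSplit u₁ u₂ u₃ (tail-≢ d₁₂) (tail-≢ d₁₃) (tail-≢ d₂₃))
... | no a₁≢a₂ | _        = proj₁ (headSplit a₁ a₂ a₃ u₁ u₂ u₃ (a₁≢a₂ ∘ proj₁) d₁₂ d₁₃ d₂₃)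
... | yes _    | no a₂≢a₃ = proj₁ (headSplit a₁ a₂ a₃ u₁ u₂ u₃ (a₂≢a₃ ∘ proj₂) d₁₂ d₁₃ d₂₃)

realizeBy : ∀ {L} {u₁ u₂ u₃ : Vec Bool L} (s : Split u₁ u₂ u₃) w → mid w ≢ Split.odd s →
            Σ Bool λ βᵢ → Σ Bool λ βⱼ → ∀ M → lookup M (Split.i s) ≡ βᵢ → lookup M (Split.j s) ≡ βⱼ →
            lexWord (u₁ ⊕ M) (u₂ ⊕ M) (u₃ ⊕ M) ≡ w
realizeBy {u₁ = u₁} {u₂} {u₃} (split k i j _ b c shape) w mid≢k with realize k w mid≢k
... | A , B , AB≡w = b xor A , c xor B , λ M Mᵢ Mⱼ → begin
  lexWord (u₁ ⊕ M) (u₂ ⊕ M) (u₃ ⊕ M)                  ≡⟨ shape M ⟩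
  shapeWord k (b xor lookup M i) (c xor lookup M j)    ≡⟨ cong₂ (λ β γ → shapeWord k (b xor β) (c xor γ)) Mᵢ Mⱼ ⟩
  shapeWord k (b xor (b xor A)) (c xor (c xor B))      ≡⟨ cong₂ (shapeWord k) (xor-cancelˡ b A) (xor-cancelˡ c B) ⟩
  shapeWord k A B                                      ≡⟨ AB≡w ⟩
  w                                                    ∎
  where open ≡-Reasoning

module LexOrdering {L : ℕ} = KeyOrdering (_≺_ {L}) ≺-irrefl (λ {u} {v} {w} → ≺-trans {u = u} {v} {w}) ≺-connex

maskedOrder : ∀ {n L} (code : Fin n → Vec Bool L) → Injective _≡_ _≡_ code → Vec Bool L → Ordering n
maskedOrder code code-inj M = LexOrdering.keyOrder (λ x → code x ⊕ M) (code-inj ∘ ⊕-injective M)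

module _ {n L : ℕ} (code : Fin n → Vec Bool L) (code-inj : Injective _≡_ _≡_ code)
         {x₁ x₂ x₃ : Fin n} (d₁₂ : x₁ ≢ x₂) (d₁₃ : x₁ ≢ x₃) (d₂₃ : x₂ ≢ x₃) where

  ord-masked : ∀ M → ord (maskedOrder code code-inj M) x₁ x₂ x₃ ≡ lexWord (code x₁ ⊕ M) (code x₂ ⊕ M) (code x₃ ⊕ M)
  ord-masked M = LexOrdering.ord-keyOrder (λ x → code x ⊕ M) (code-inj ∘ ⊕-injective M) d₁₂ d₁₃ d₂₃

  codeSplit : Split (code x₁) (code x₂) (code x₃)
  codeSplit = tripleSplit (code x₁) (code x₂) (code x₃) (d₁₂ ∘ code-inj) (d₁₃ ∘ code-inj) (d₂₃ ∘ code-inj)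

  maskedHit : ∀ {Π : SubS3} (s : Split (code x₁) (code x₂) (code x₃)) {w} → Π w ≡ true → mid w ≢ Split.odd s →
              Σ Bool λ βᵢ → Σ Bool λ βⱼ → ∀ M → lookup M (Split.i s) ≡ βᵢ → lookup M (Split.j s) ≡ βⱼ →
              Π (ord (maskedOrder code code-inj M) x₁ x₂ x₃) ≡ true
  maskedHit {Π} s {w} Πw mid≢odd =
    let βᵢ , βⱼ , realized = realizeBy s w mid≢odd in
    βᵢ , βⱼ , λ M Mᵢ Mⱼ → subst (λ v → Π v ≡ true) (sym (trans (ord-masked M) (realized M Mᵢ Mⱼ))) Πw

-- Bits as elements of Fin 2, to use the library's numbering funToFin of
-- the functions Fin k → Fin 2.
toBit : Bool → Fin 2
toBit false = zero
toBit true  = suc zero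

fromBit : Fin 2 → Bool
fromBit zero       = false
fromBit (suc zero) = true

fromBit-toBit : ∀ b → fromBit (toBit b) ≡ b
fromBit-toBit false = refl
fromBit-toBit true  = refl

toBit-fromBit : ∀ q → toBit (fromBit q) ≡ q
toBit-fromBit zero       = refl
toBit-fromBit (suc zero) = refl

funToFin-cong : ∀ {k m} {f g : Fin k → Fin m} → f ≗ g → funToFin f ≡ funToFin g
funToFin-cong {zero}  _   = refl
funToFin-cong {suc k} f≗g = cong₂ combine (f≗g zero) (funToFin-cong (f≗g ∘ suc))

patternIndex : ∀ {k} → (Fin k → Bool) → Fin (2 ^ k)
patternIndex p = funToFin (toBit ∘ p)

indexPattern : ∀ {k} → Fin (2 ^ k) → Fin k → Bool
indexPattern q = fromBit ∘ finToFun q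

indexPattern-patternIndex : ∀ {k} (p : Fin k → Bool) → indexPattern (patternIndex p) ≗ p
indexPattern-patternIndex p i = trans (cong fromBit (finToFun-funToFin (toBit ∘ p) i)) (fromBit-toBit (p i))

patternIndex-indexPattern : ∀ {k} (q : Fin (2 ^ k)) → patternIndex (indexPattern {k} q) ≡ q
patternIndex-indexPattern {k} q = trans (funToFin-cong {k} {2} (λ i → toBit-fromBit (finToFun q i))) (funToFin-finToFin {k} q)

pattern-bound : ∀ {n k} (p : Fin n → Fin k → Bool) → (∀ {x y} → p x ≗ p y → x ≡ y) → n ≤ 2 ^ k
pattern-bound p p-inj = injective⇒≤ {f = patternIndex ∘ p} λ {x} {y} eq → p-inj λ i → begin
  p x i                           ≡⟨ sym (indexPattern-patternIndex (p x) i) ⟩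
  indexPattern (patternIndex (p x)) i ≡⟨ cong (λ q → indexPattern q i) eq ⟩
  indexPattern (patternIndex (p y)) i ≡⟨ indexPattern-patternIndex (p y) i ⟩
  p y i                           ∎
  where open ≡-Reasoning

binaryCode : ∀ {n L} → n ≤ 2 ^ L → Fin n → Vec Bool L
binaryCode {L = L} n≤ x = tabulate (indexPattern {L} (inject≤ x n≤))

binaryCode-injective : ∀ {n L} (n≤ : n ≤ 2 ^ L) → Injective _≡_ _≡_ (binaryCode n≤)
binaryCode-injective {L = L} n≤ {x} {y} eq = inject≤-injective n≤ n≤ x y (begin
  inject≤ x n≤                                    ≡⟨ sym (patternIndex-indexPattern {L} _) ⟩
  patternIndex (indexPattern {L} (inject≤ x n≤))  ≡⟨ funToFin-cong (cong toBit ∘ same) ⟩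
  patternIndex (indexPattern {L} (inject≤ y n≤))  ≡⟨ patternIndex-indexPattern {L} _ ⟩
  inject≤ y n≤                                    ∎)
  where
  open ≡-Reasoning
  same : indexPattern {L} (inject≤ x n≤) ≗ indexPattern (inject≤ y n≤)
  same i = trans (sym (lookup∘tabulate _ i)) (trans (cong (λ v → lookup v i) eq) (lookup∘tabulate _ i))

SolvesBy : SubS3 → (n : ℕ) {I : Set} → (I → Ordering n) → Set
SolvesBy Π n {I} Φ = (x₁ x₂ x₃ : Fin n) → x₁ ≢ x₂ → x₁ ≢ x₃ → x₂ ≢ x₃ →
                     Σ I λ ι → Π (ord (Φ ι) x₁ x₂ x₃) ≡ true

enumerate : ∀ {Π n m k} {I : Set} (Φ : I → Ordering n) (f : Fin m → I) →
            (∀ ι → Σ (Fin m) λ q → f q ≡ ι) → m ≤ k → SolvesBy Π n Φ → pLe Π n k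
enumerate {Π} Φ f f-onto m≤k solves =
  _ , m≤k , Φ ∘ f , λ x₁ x₂ x₃ d₁₂ d₁₃ d₂₃ →
    let ι , hit = solves x₁ x₂ x₃ d₁₂ d₁₃ d₂₃
        q , fq≡ι = f-onto ι
    in  q , subst (λ ι → Π (ord (Φ ι) x₁ x₂ x₃) ≡ true) (sym fq≡ι) hit

fromBit-onto : ∀ b → Σ (Fin 2) λ q → fromBit q ≡ b
fromBit-onto b = toBit b , fromBit-toBit b

bitPair : Fin 4 → Bool × Bool
bitPair r = map fromBit fromBit (remQuot {2} 2 r)

withBitPair : ∀ {L} → Fin (L * 4) → Fin L × Bool × Bool
withBitPair {L} q = map₂ bitPair (remQuot {L} 4 q)

withBitPair-onto : ∀ {L} (ι : Fin L × Bool × Bool) → Σ (Fin (L * 4)) λ q → withBitPair q ≡ ι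
withBitPair-onto {L} (i , β , γ) = combine i (combine (toBit β) (toBit γ)) , (begin
  withBitPair (combine i (combine (toBit β) (toBit γ)))
    ≡⟨ cong (map₂ bitPair) (remQuot-combine {L} {4} i _) ⟩
  (i , map fromBit fromBit (remQuot {2} 2 (combine (toBit β) (toBit γ))))
    ≡⟨ cong (λ r → i , map fromBit fromBit r) (remQuot-combine {2} {2} (toBit β) (toBit γ)) ⟩
  (i , fromBit (toBit β) , fromBit (toBit γ))
    ≡⟨ cong₂ (λ β′ γ′ → i , β′ , γ′) (fromBit-toBit β) (fromBit-toBit γ) ⟩
  (i , β , γ) ∎)
  where open ≡-Reasoning

-- Masks with prescribed values at any two distinct positions of [L]: for a
-- bit r of the position codes and values g₀ g₁, put g₁ where bit r is set.
coordMask : ∀ {L t} → (Fin L → Vec Bool t) → Fin t × Bool × Bool → Vec Bool L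
coordMask pcode (r , g₀ , g₁) = tabulate (λ p → if lookup (pcode p) r then g₁ else g₀)

select : ∀ {x y : Bool} → x ≢ y → ∀ βx βy →
         Σ Bool λ g₀ → Σ Bool λ g₁ → (if x then g₁ else g₀) ≡ βx × (if y then g₁ else g₀) ≡ βy
select {false} {false} x≢y _  _  = contradiction refl x≢y
select {false} {true}  _   βx βy = βx , βy , refl , refl
select {true}  {false} _   βx βy = βy , βx , refl , refl
select {true}  {true}  x≢y _  _  = contradiction refl x≢y

coordMask-prescribes : ∀ {L t} (pcode : Fin L → Vec Bool t) → Injective _≡_ _≡_ pcode →
                       ∀ {i j} → i ≢ j → ∀ βᵢ βⱼ → Σ (Fin t × Bool × Bool) λ ι →
                       lookup (coordMask pcode ι) i ≡ βᵢ × lookup (coordMask pcode ι) j ≡ βⱼ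
coordMask-prescribes pcode pcode-inj {i} {j} i≢j βᵢ βⱼ =
  let r , differ , _      = firstDiff (pcode i) (pcode j) (i≢j ∘ pcode-inj)
      g₀ , g₁ , atᵢ , atⱼ = select differ βᵢ βⱼ
  in  (r , g₀ , g₁) , trans (lookup∘tabulate _ i) atᵢ , trans (lookup∘tabulate _ j) atⱼ

prefixed : ∀ {L} → Fin L → Vec Bool L → Vec Bool (suc L)
prefixed col u = lookup u col ∷ u

prefixMask : ∀ {L} → Bool → Bool → Vec Bool (suc L)
prefixMask {L} β γ = β ∷ replicate L γ

prefixMask-lookup : ∀ {L} {β γ} (j : Fin (suc L)) → j ≢ zero → lookup (prefixMask β γ) j ≡ γ
prefixMask-lookup zero    j≢0 = contradiction refl j≢0
prefixMask-lookup (suc j) _   = lookup-replicate j _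

prefixSplit : ∀ {L} (col : Fin L) {u₁ u₂ u₃ : Vec Bool L} r →
              lookup (pick u₁ u₂ u₃ (other₁ r)) col ≢ lookup (pick u₁ u₂ u₃ (other₂ r)) col →
              prefixed col u₁ ≢ prefixed col u₂ → prefixed col u₁ ≢ prefixed col u₃ →
              prefixed col u₂ ≢ prefixed col u₃ →
              Σ (Split (prefixed col u₁) (prefixed col u₂) (prefixed col u₃)) λ s →
                Split.i s ≡ zero × Split.odd s ≢ r
prefixSplit col {u₁} {u₂} {u₃} r differ d₁₂ d₁₃ d₂₃ =
  s , at-front , λ odd≡r → heads-differ (subst (λ k → head (other₁ k) ≡ head (other₂ k)) odd≡r others-agree)
  where
  head : Idx → Bool
  head = pick (lookup u₁ col) (lookup u₂ col) (lookup u₃ col)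
  heads-differ : head (other₁ r) ≢ head (other₂ r)
  heads-differ eq = differ (trans (sym (pick-map (λ u → lookup u col) u₁ u₂ u₃ (other₁ r)))
                           (trans eq (pick-map (λ u → lookup u col) u₁ u₂ u₃ (other₂ r))))
  result = headSplit (lookup u₁ col) (lookup u₂ col) (lookup u₃ col) u₁ u₂ u₃
                     (pick-notAllEqual r heads-differ) d₁₂ d₁₃ d₂₃
  s = proj₁ result
  at-front = proj₁ (proj₂ result)
  others-agree = proj₂ (proj₂ result)

module _ {n L : ℕ} (code : Fin n → Vec Bool L) (code-inj : Injective _≡_ _≡_ code) where

  -- c = 0: the all-0 and the all-1 mask give a word and its reversal.
  complementOrder : Bool → Ordering n
  complementOrder β = maskedOrder code code-inj (replicate L β)

  complementOrders-solve : ∀ {Π} → (∀ a → emptyMid Π a ≡ false) → SolvesBy Π n complementOrder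
  complementOrders-solve {Π} meetsAll x₁ x₂ x₃ d₁₂ d₁₃ d₂₃ =
    Sum.[ (λ hit → false , subst (λ v → Π v ≡ true) (sym word-false) hit)
        , (λ hit → true  , subst (λ v → Π v ≡ true) (sym word-true)  hit) ]
      (cover Π (shapeWord odd b c) (meetsAll (mid (shapeWord odd b c))))
    where
    open Split (codeSplit code code-inj d₁₂ d₁₃ d₂₃)
    word : ∀ β → ord (complementOrder β) x₁ x₂ x₃ ≡ shapeWord odd (b xor β) (c xor β)
    word β = trans (ord-masked code code-inj d₁₂ d₁₃ d₂₃ (replicate L β))
                   (trans (shape (replicate L β))
                          (cong₂ (λ βᵢ βⱼ → shapeWord odd (b xor βᵢ) (c xor βⱼ))
                                 (lookup-replicate i β) (lookup-replicate j β)))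
    word-false : ord (complementOrder false) x₁ x₂ x₃ ≡ shapeWord odd b c
    word-false = trans (word false) (cong₂ (shapeWord odd) (xor-identityʳ b) (xor-identityʳ c))
    word-true : ord (complementOrder true) x₁ x₂ x₃ ≡ rev (shapeWord odd b c)
    word-true = trans (word true) (trans (cong₂ (shapeWord odd) (xor-true b) (xor-true c))
                                         (shapeWord-flip odd b c))

  coordOrder : ∀ {t} → (Fin L → Vec Bool t) → Fin t × Bool × Bool → Ordering n
  coordOrder pcode ι = maskedOrder code code-inj (coordMask pcode ι)

  coordOrders-solve : ∀ {Π t} (pcode : Fin L → Vec Bool t) → Injective _≡_ _≡_ pcode →
                      (∀ k → Σ S3 λ w → mid w ≢ k × Π w ≡ true) → SolvesBy Π n (coordOrder pcode)
  coordOrders-solve {Π} pcode pcode-inj avoiding x₁ x₂ x₃ d₁₂ d₁₃ d₂₃ =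
    let s                 = codeSplit code code-inj d₁₂ d₁₃ d₂₃
        w , mid≢odd , Πw  = avoiding (Split.odd s)
        βᵢ , βⱼ , hit     = maskedHit code code-inj d₁₂ d₁₃ d₂₃ {Π} s Πw mid≢odd
        ι , Mᵢ , Mⱼ       = coordMask-prescribes pcode pcode-inj (Split.i≢j s) βᵢ βⱼ
    in  ι , hit (coordMask pcode ι) Mᵢ Mⱼ

  prefixCode : Fin L → Fin n → Vec Bool (suc L)
  prefixCode col x = prefixed col (code x)

  prefixCode-injective : ∀ col → Injective _≡_ _≡_ (prefixCode col)
  prefixCode-injective col = code-inj ∘ ∷-injectiveʳ

  prefixOrder : Fin L × Bool × Bool → Ordering n
  prefixOrder (col , β , γ) = maskedOrder (prefixCode col) (prefixCode-injective col) (prefixMask β γ)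

  prefixOrders-solve : ∀ {Π w} → Π w ≡ true → SolvesBy Π n prefixOrder
  prefixOrders-solve {Π} {w} Πw x₁ x₂ x₃ d₁₂ d₁₃ d₂₃ =
    let codes            = pick (code x₁) (code x₂) (code x₃)
        col , differ , _ = firstDiff (codes (other₁ (mid w))) (codes (other₂ (mid w)))
                             (pick-distinct (d₁₂ ∘ code-inj) (d₁₃ ∘ code-inj) (d₂₃ ∘ code-inj) (mid w))
        inj              = prefixCode-injective col
        s , at-front , odd≢mid = prefixSplit col (mid w) differ (d₁₂ ∘ inj) (d₁₃ ∘ inj) (d₂₃ ∘ inj)
        βᵢ , βⱼ , hit    = maskedHit (prefixCode col) inj d₁₂ d₁₃ d₂₃ {Π} s Πw (odd≢mid ∘ sym)
    in  (col , βᵢ , βⱼ) ,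
        hit (prefixMask βᵢ βⱼ) (cong (lookup (prefixMask βᵢ βⱼ)) at-front)
            (prefixMask-lookup (Split.j s) (λ j≡0 → Split.i≢j s (trans at-front (sym j≡0))))

ordAt : ∀ {n} → Ordering n → Idx → Fin n → Fin n → Fin n → S3
ordAt φ i1 x y z = ord φ x y z
ordAt φ i2 x y z = ord φ y x z
ordAt φ i3 x y z = ord φ y z x

solveAt : ∀ {Π n m} {Φ : Fin m → Ordering n} → Solves Π n m Φ →
          ∀ a {x y z} → x ≢ y → x ≢ z → y ≢ z → Σ (Fin m) λ i → Π (ordAt (Φ i) a x y z) ≡ true
solveAt solves i1 x≢y x≢z y≢z = solves _ _ _ x≢y x≢z y≢z
solveAt solves i2 x≢y x≢z y≢z = solves _ _ _ (≢-sym x≢y) y≢z x≢z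
solveAt solves i3 x≢y x≢z y≢z = solves _ _ _ y≢z (≢-sym x≢y) (≢-sym x≢z)

-- ordAt in terms of α = "y before x", β = "z before x", γ = "y before z".
slotWord : Idx → Bool → Bool → Bool → S3
slotWord i1 α β γ = word3 (not α) γ (not β)
slotWord i2 α β γ = word3 α (not β) γ
slotWord i3 α β γ = word3 γ β α

ordAt-slotWord : ∀ {n} (φ : Ordering n) a {x y z} → x ≢ y → x ≢ z →
                 ordAt φ a x y z ≡ slotWord a (before φ y x) (before φ z x) (before φ y z)
ordAt-slotWord φ i1 {x} {y} {z} x≢y x≢z =
  cong₂ (λ α β → word3 α (before φ y z) β) (before-flip φ x≢y) (before-flip φ x≢z)
ordAt-slotWord φ i2 {x} {y} {z} x≢y x≢z =
  cong (λ β → word3 (before φ y x) β (before φ y z)) (before-flip φ x≢z)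
ordAt-slotWord φ i3 x≢y x≢z = refl

-- The middle letter when α = β, and when α ≠ β (then γ = α by transitivity).
midAway : ∀ a α γ → mid (slotWord a α α γ) ≢ a
midAway i1 false false = λ ()
midAway i1 false true  = λ ()
midAway i1 true  false = λ ()
midAway i1 true  true  = λ ()
midAway i2 false false = λ ()
midAway i2 false true  = λ ()
midAway i2 true  false = λ ()
midAway i2 true  true  = λ ()
midAway i3 false false = λ ()
midAway i3 false true  = λ ()
midAway i3 true  false = λ ()
midAway i3 true  true  = λ ()

midAt : ∀ a β → mid (slotWord a (not β) β (not β)) ≡ a
midAt i1 false = refl
midAt i1 true  = refl
midAt i2 false = refl
midAt i2 true  = refl
midAt i3 false = refl
midAt i3 true  = refl

mid-sameSide : ∀ {n} (φ : Ordering n) a {x y z} → x ≢ y → x ≢ z →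
               before φ y x ≡ before φ z x → mid (ordAt φ a x y z) ≢ a
mid-sameSide φ a {x} {y} {z} x≢y x≢z same =
  subst (λ v → mid v ≢ a) (sym (trans (ordAt-slotWord φ a x≢y x≢z)
                                      (cong (λ α → slotWord a α (before φ z x) (before φ y z)) same)))
        (midAway a (before φ z x) (before φ y z))

mid-between : ∀ {n} (φ : Ordering n) a {x y z} → x ≢ y → x ≢ z → y ≢ z →
              before φ y x ≡ not (before φ z x) → mid (ordAt φ a x y z) ≡ a
mid-between φ a {x} {y} {z} x≢y x≢z y≢z between = begin
  mid (ordAt φ a x y z)                                         ≡⟨ cong mid (ordAt-slotWord φ a x≢y x≢z) ⟩
  mid (slotWord a (before φ y x) (before φ z x) (before φ y z))  ≡⟨ cong (λ γ → mid (slotWord a (before φ y x) (before φ z x) γ)) y-side ⟩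
  mid (slotWord a (before φ y x) (before φ z x) (before φ y x))  ≡⟨ cong (λ α → mid (slotWord a α (before φ z x) α)) between ⟩
  mid (slotWord a (not β) β (not β))                            ≡⟨ midAt a β ⟩
  a                                                             ∎
  where
  open ≡-Reasoning
  β = before φ z x
  y-side : before φ y z ≡ before φ y x
  y-side = <ᵇ-between (pos-≢ φ x≢y) (pos-≢ φ x≢z) (pos-≢ φ y≢z) between

-- Every word is read by any ordering on the elements it puts at suitable
-- places among the first three.
letterPos : ∀ {n} → S3 → Idx → Fin (3 + n)
letterPos w123 = pick zero (suc zero) (suc (suc zero))
letterPos w132 = pick zero (suc (suc zero)) (suc zero)
letterPos w213 = pick (suc zero) zero (suc (suc zero))
letterPos w231 = pick (suc (suc zero)) zero (suc zero)
letterPos w312 = pick (suc zero) (suc (suc zero)) zero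
letterPos w321 = pick (suc (suc zero)) (suc zero) zero

letterPos-word : ∀ {n} w → wordOf (toℕ (letterPos {n} w i1)) (toℕ (letterPos {n} w i2)) (toℕ (letterPos {n} w i3)) ≡ w
letterPos-word w123 = refl
letterPos-word w132 = refl
letterPos-word w213 = refl
letterPos-word w231 = refl
letterPos-word w312 = refl
letterPos-word w321 = refl

letterPos-distinct : ∀ {n} w → letterPos {n} w i1 ≢ letterPos w i2 × letterPos {n} w i1 ≢ letterPos w i3 ×
                               letterPos {n} w i2 ≢ letterPos w i3
letterPos-distinct w123 = (λ ()) , (λ ()) , (λ ())
letterPos-distinct w132 = (λ ()) , (λ ()) , (λ ())
letterPos-distinct w213 = (λ ()) , (λ ()) , (λ ())
letterPos-distinct w231 = (λ ()) , (λ ()) , (λ ())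
letterPos-distinct w312 = (λ ()) , (λ ()) , (λ ())
letterPos-distinct w321 = (λ ()) , (λ ()) , (λ ())

ord-inverse : ∀ {n} (φ : Ordering n) p₁ p₂ p₃ →
              ord φ (φ ⟨$⟩ˡ p₁) (φ ⟨$⟩ˡ p₂) (φ ⟨$⟩ˡ p₃) ≡ wordOf (toℕ p₁) (toℕ p₂) (toℕ p₃)
ord-inverse φ p₁ p₂ p₃ rewrite inverseʳ φ {p₁} | inverseʳ φ {p₂} | inverseʳ φ {p₃} = refl

inverse-≢ : ∀ {n} (φ : Ordering n) {p q} → p ≢ q → φ ⟨$⟩ˡ p ≢ φ ⟨$⟩ˡ q
inverse-≢ φ p≢q eq = p≢q (trans (sym (inverseʳ φ)) (trans (cong (φ ⟨$⟩ʳ_) eq) (inverseʳ φ)))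

-- One ordering yields only one word per constraint, so it cannot solve Π ≠ S₃.
lower-two : ∀ {Π w n m} {Φ : Fin m → Ordering (3 + n)} → Π w ≡ false → Solves Π (3 + n) m Φ → 2 ≤ m
lower-two {m = zero} _ solves with () ← proj₁ (solves zero (suc zero) (suc (suc zero)) (λ ()) (λ ()) (λ ()))
lower-two {m = suc (suc m)} _ _ = s≤s (s≤s z≤n)
lower-two {Π} {w} {n} {suc zero} {Φ} Πw≡false solves =
  contradiction (trans (sym (subst (λ v → Π v ≡ true) reads-w (only-one solved))) Πw≡false) λ ()
  where
  φ = Φ zero
  at : Idx → Fin (3 + n)
  at l = φ ⟨$⟩ˡ letterPos w l
  reads-w : ord φ (at i1) (at i2) (at i3) ≡ w
  reads-w = trans (ord-inverse φ _ _ _) (letterPos-word {n} w)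
  distinct = letterPos-distinct {n} w
  solved = solves (at i1) (at i2) (at i3) (inverse-≢ φ (proj₁ distinct)) (inverse-≢ φ (proj₁ (proj₂ distinct)))
                  (inverse-≢ φ (proj₂ (proj₂ distinct)))
  only-one : ∀ {P : Fin 1 → Set} → Σ (Fin 1) P → P zero
  only-one (zero , p) = p

-- If Π ⊆ M_a, the other elements lie on pairwise different patterns of
-- sides of the first element, whence n ≤ 2 ^ m.
lower-log : ∀ {Π n m} {Φ : Fin m → Ordering (suc n)} a → (∀ w → mid w ≢ a → Π w ≡ false) →
            Solves Π (suc n) m Φ → n ≤ 2 ^ m
lower-log {Π} {n} {m} {Φ} a inside solves = pattern-bound side side-injective
  where
  side : Fin n → Fin m → Bool
  side y i = before (Φ i) (suc y) zero
  side-injective : ∀ {y z} → side y ≗ side z → y ≡ z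
  side-injective {y} {z} same with y ≟ᶠ z
  ... | yes y≡z = y≡z
  ... | no  y≢z =
    let i , hit = solveAt {Π} {Φ = Φ} solves a {zero} {suc y} {suc z} (λ ()) (λ ()) (y≢z ∘ suc-injective)
    in  contradiction (trans (sym hit) (inside _ (mid-sameSide (Φ i) a (λ ()) (λ ()) (same i)))) λ ()

fromDoes : ∀ {A : Set} (a? : Dec A) → does a? ≡ true → A
fromDoes (yes a) _ = a

-- If Π ∩ M_c = ∅, no element lies between two others in every ordering;
-- the sets of side patterns realised around the elements are therefore
-- pairwise different, whence n ≤ 2 ^ 2 ^ m (for m ≥ 1, given by an index i₀).
module _ {Π : SubS3} {n m : ℕ} {Φ : Fin m → Ordering n} where

  Realised : Fin n → (Fin m → Bool) → Set
  Realised x p = Σ (Fin n) λ w → w ≢ x × (∀ i → before (Φ i) w x ≡ p i)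

  realised? : ∀ x p → Dec (Realised x p)
  realised? x p = any? λ w → ¬? (w ≟ᶠ x) ×-dec all? (λ i → before (Φ i) w x ≟ᵇ p i)

  lower-loglog : ∀ c → (∀ w → mid w ≡ c → Π w ≡ false) → Fin m → Solves Π n m Φ → n ≤ 2 ^ 2 ^ m
  lower-loglog c outside i₀ solves = pattern-bound realisedSet realisedSet-injective
    where
    realisedSet : Fin n → Fin (2 ^ m) → Bool
    realisedSet x q = does (realised? x (indexPattern q))
    realisedSet-injective : ∀ {x y} → realisedSet x ≗ realisedSet y → x ≡ y
    realisedSet-injective {x} {y} same with x ≟ᶠ y
    ... | yes x≡y = x≡y
    ... | no  x≢y = contradiction (trans (sym hit) (outside _ (mid-between (Φ i) c x≢w x≢y w≢y w-x-y))) λ ()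
      where
      -- the pattern "x before y" is realised around y (by x), hence around x by some w
      p = λ i → before (Φ i) x y
      at-p = indexPattern-patternIndex p
      around-y : Realised y (indexPattern (patternIndex p))
      around-y = x , x≢y , λ i → sym (at-p i)
      around-x : Realised x (indexPattern (patternIndex p))
      around-x = fromDoes (realised? x _) (trans (same _) (dec-true (realised? y _) around-y))
      w = proj₁ around-x
      x≢w = ≢-sym (proj₁ (proj₂ around-x))
      w-x-y : ∀ {i} → before (Φ i) w x ≡ not (before (Φ i) y x)
      w-x-y {i} = trans (proj₂ (proj₂ around-x) i) (trans (at-p i) (before-flip (Φ i) x≢y))
      w≢y : w ≢ y
      w≢y w≡y = not-¬ refl (trans (cong (λ v → before (Φ i₀) v x) (sym w≡y)) (w-x-y {i₀}))
      solved = solveAt {Π} {Φ = Φ} solves c x≢w x≢y w≢y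
      i = proj₁ solved
      hit = proj₂ solved

pow≤⇒≤log : ∀ {n b} → 2 ^ b ≤ n → b ≤ ⌊log₂ n ⌋
pow≤⇒≤log {n} {b} h = subst (_≤ ⌊log₂ n ⌋) (⌊log₂[2^n]⌋≡n b) (⌊log₂⌋-mono-≤ h)

≤pow⇒log≤ : ∀ {n b} → n ≤ 2 ^ b → ⌊log₂ n ⌋ ≤ b
≤pow⇒log≤ {n} {b} h = subst (⌊log₂ n ⌋ ≤_) (⌊log₂[2^n]⌋≡n b) (⌊log₂⌋-mono-≤ h)

<pow-suc-log : ∀ n → n < 2 ^ suc ⌊log₂ n ⌋
<pow-suc-log n with 2 ^ suc ⌊log₂ n ⌋ ≤? n
... | yes too-big = contradiction (pow≤⇒≤log too-big) 1+n≰n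
... | no  fits    = ≰⇒> fits

logCode : ∀ n → Fin n → Vec Bool (suc ⌊log₂ n ⌋)
logCode n = binaryCode {n} {suc ⌊log₂ n ⌋} (<⇒≤ (<pow-suc-log n))

logCode-injective : ∀ n → Injective _≡_ _≡_ (logCode n)
logCode-injective n = binaryCode-injective {n} {suc ⌊log₂ n ⌋} (<⇒≤ (<pow-suc-log n))

suc≤pow-suc : ∀ {n m} → n ≤ 2 ^ m → suc n ≤ 2 ^ suc m
suc≤pow-suc {n} {m} h =
  ≤-trans (+-mono-≤ (m^n>0 2 m) h) (≤-reflexive (cong (2 ^ m +_) (sym (+-identityʳ (2 ^ m)))))

suc*4≤8* : ∀ {k} → 1 ≤ k → suc k * 4 ≤ 8 * k
suc*4≤8* {k} 1≤k = ≤-trans (*-monoˡ-≤ 4 (+-monoˡ-≤ k 1≤k)) (≤-reflexive (quadruple k))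
  where
  quadruple : ∀ k → (k + k) * 4 ≡ 8 * k
  quadruple = solve-∀

case-c0 : ∀ Π {w₀} → Π w₀ ≡ false → cCount Π ≡ 0 → (n : ℕ) → 3 ≤ n → pEq Π n 2
case-c0 Π Πw₀ c≡0 (suc (suc (suc n))) (s≤s (s≤s (s≤s _))) =
  enumerate {Π} (complementOrder (logCode (3 + n)) (logCode-injective (3 + n))) fromBit fromBit-onto ≤-refl
    (complementOrders-solve (logCode (3 + n)) (logCode-injective (3 + n)) (count₀ (emptyMid Π) c≡0)) ,
  λ m Φ → lower-two {Π} {Φ = Φ} Πw₀

case-c1 : ∀ Π {w₀} → Π w₀ ≡ false → cCount Π ≡ 1 → PTheta Π (λ n → ⌊log₂ ⌊log₂ n ⌋ ⌋)
case-c1 Π {w₀} Πw₀ c≡1 = 8 , 4 , λ n 4≤n → upper n 4≤n , lower n 4≤n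
  where
  missed = count₁ (emptyMid Π) c≡1
  c = proj₁ missed
  -- Π meets both classes other than M_c, so it avoids any given middle letter
  avoiding : ∀ k → Σ S3 λ w → mid w ≢ k × Π w ≡ true
  avoiding k = Sum.[ via (other₁ c) (proj₁ (proj₂ (proj₂ missed)))
                   , via (other₂ c) (proj₂ (proj₂ (proj₂ missed))) ] (other-avoids c k)
    where
    via : ∀ a → emptyMid Π a ≡ false → a ≢ k → Σ S3 λ w → mid w ≢ k × Π w ≡ true
    via a meets-a a≢k = let w , mid≡a , Πw = meets Π a meets-a in w , a≢k ∘ trans (sym mid≡a) , Πw
  upper : ∀ n → 4 ≤ n → pLe Π n (8 * ⌊log₂ ⌊log₂ n ⌋ ⌋)
  upper n 4≤n = enumerate {Π} (coordOrder (logCode n) (logCode-injective n) pcode)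
                  withBitPair withBitPair-onto (suc*4≤8* (pow≤⇒≤log {⌊log₂ n ⌋} {1} (pow≤⇒≤log {n} {2} 4≤n)))
                  (coordOrders-solve (logCode n) (logCode-injective n) pcode pcode-injective avoiding)
    where
    pcode : Fin (suc ⌊log₂ n ⌋) → Vec Bool (suc ⌊log₂ ⌊log₂ n ⌋ ⌋)
    pcode = binaryCode (<pow-suc-log ⌊log₂ n ⌋)
    pcode-injective : Injective _≡_ _≡_ pcode
    pcode-injective = binaryCode-injective (<pow-suc-log ⌊log₂ n ⌋)
  lower : ∀ n → 4 ≤ n → (m : ℕ) (Φ : Fin m → Ordering n) → Solves Π n m Φ → ⌊log₂ ⌊log₂ n ⌋ ⌋ ≤ 8 * m
  lower (suc (suc (suc n))) (s≤s (s≤s (s≤s _))) zero    Φ solves = contradiction (lower-two {Π} {Φ = Φ} Πw₀ solves) λ ()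
  lower (suc (suc (suc n))) (s≤s (s≤s (s≤s _))) (suc m) Φ solves =
    ≤-trans (≤pow⇒log≤ (≤pow⇒log≤ (lower-loglog {Π} {Φ = Φ} c (disjoint Π c (proj₁ (proj₂ missed))) zero solves)))
            (m≤n*m (suc m) 8)

case-c2 : ∀ Π {w₁ w₀} → Π w₁ ≡ true → Π w₀ ≡ false → cCount Π ≡ 2 → PTheta Π (λ n → ⌊log₂ n ⌋)
case-c2 Π Πw₁ Πw₀ c≡2 = 8 , 3 , λ { (suc (suc (suc n))) (s≤s (s≤s (s≤s _))) → upper n , lower n }
  where
  a = proj₁ (count₂ (emptyMid Π) c≡2)
  inside : ∀ w → mid w ≢ a → Π w ≡ false
  inside w mid≢a = disjoint Π (mid w) (proj₂ (count₂ (emptyMid Π) c≡2) (mid w) mid≢a) w refl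
  upper : ∀ n → pLe Π (3 + n) (8 * ⌊log₂ (3 + n) ⌋)
  upper n = enumerate {Π} (prefixOrder (logCode (3 + n)) (logCode-injective (3 + n)))
              withBitPair withBitPair-onto (suc*4≤8* (pow≤⇒≤log {3 + n} {1} (s≤s (s≤s z≤n))))
              (prefixOrders-solve (logCode (3 + n)) (logCode-injective (3 + n)) {Π} Πw₁)
  lower : ∀ n (m : ℕ) (Φ : Fin m → Ordering (3 + n)) → Solves Π (3 + n) m Φ → ⌊log₂ (3 + n) ⌋ ≤ 8 * m
  lower n m Φ solves =
    ≤-trans (≤pow⇒log≤ (suc≤pow-suc {2 + n} {m} (lower-log {Π} {Φ = Φ} a inside solves)))
            (≤-trans (m≤m*n (suc m) 4) (suc*4≤8* (≤-trans (s≤s z≤n) (lower-two {Π} {Φ = Φ} Πw₀ solves))))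

theorem4p4 : (Π : SubS3) →
    Σ S3 (λ w → Π w ≡ true) →
    Σ S3 (λ w → Π w ≡ false) →
    ((cCount Π ≡ 0 → (n : ℕ) → 3 ≤ n → pEq Π n 2) ×
     (cCount Π ≡ 1 → PTheta Π (λ n → ⌊log₂ ⌊log₂ n ⌋ ⌋)) ×
     (cCount Π ≡ 2 → PTheta Π (λ n → ⌊log₂ n ⌋)))
theorem4p4 Π (w₁ , Πw₁) (w₀ , Πw₀) = case-c0 Π Πw₀ , case-c1 Π Πw₀ , case-c2 Π Πw₁ Πw₀
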